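{- For every base $\mathcal{B}$, atomic multisets $L$ and $K$, and atom $p$: $L\Vdash^{K}_{\mathcal{B}}p$ (with $L$ regarded as a multiset of atomic formulae) if and only if $L\uplus K\vdash_{\mathcal{B}}p$.
   Context: Fix a set $\mathbb{A}$ of propositional atoms. All multisets are finite; $\uplus$ denotes multiset union; an atomic multiset is a finite multiset of atoms. Formulae: $\varphi ::= p\in\mathbb{A}\mid\top\mid 0\mid 1\mid\varphi\multimap\varphi\mid\varphi\otimes\varphi\mid\varphi\mathbin{\&}\varphi\mid\varphi\oplus\varphi\mid\,!\varphi$. Bases. An atomic sequent is a pair $P\Rightarrow p$ ($P$ atomic multiset, $p$ atom); an atomic box is a finite multiset of atomic sequents; an atomic rule is a triple $\langle\mathbf{A},\mathbf{S},p\rangle$ with $\mathbf{A}$ a finite multiset of atomic boxes, $\mathbf{S}$ an atomic box, $p$ an atom. A base is a set of atomic rules; $\mathcal{C}\supseteq\mathcal{B}$ is set inclusion. An atom $p$ is persistent in $\mathcal{B}$ if $\mathcal{B}$ contains a rule $\langle\varnothing,\mathbf{S},p\rangle$ with $\mathbf{S}\neq\varnothing$. Derivability $P\vdash_{\mathcal{B}}p$ is the smallest relation closed under: (Ref) $\{p\}\vdash_{\mathcal{B}}p$; (App) if $\langle\mathbf{A},\mathbf{S},p\rangle\in\mathcal{B}$ with $\mathbf{A}=\{\mathbf{T}_1,\dots,\mathbf{T}_m\}$, and there are $n\ge m$, atomic multisets $C_1,\dots,C_n$ and a multiset $D=\{d_{m+1},\dots,d_n\}$ of atoms persistent in $\mathcal{B}$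 with $C_i\uplus Q\vdash_{\mathcal{B}}q$ for all $i\le m$ and $Q\Rightarrow q\in\mathbf{T}_i$, $C_j\vdash_{\mathcal{B}}d_j$ for all $m<j\le n$, and $D\uplus U\vdash_{\mathcal{B}}v$ for all $U\Rightarrow v\in\mathbf{S}$, then $C_1\uplus\dots\uplus C_n\vdash_{\mathcal{B}}p$. Support. For a base $\mathcal{B}$, atomic multiset $L$: (At) $\Vdash^L_{\mathcal{B}}p$ iff $L\vdash_{\mathcal{B}}p$; ($\multimap$) $\Vdash^L_{\mathcal{B}}\varphi\multimap\psi$ iff $\varphi\Vdash^L_{\mathcal{B}}\psi$; ($\otimes$) $\Vdash^L_{\mathcal{B}}\varphi\otimes\psi$ iff for all $\mathcal{C}\supseteq\mathcal{B}$, atomic multisets $K$, atoms $p$: if $\{\varphi,\psi\}\Vdash^K_{\mathcal{C}}p$ then $\Vdash^{L\uplus K}_{\mathcal{C}}p$; ($1$) $\Vdash^L_{\mathcal{B}}1$ iff for all $\mathcal{C}\supseteq\mathcal{B}$, $K$, $p$: if $\Vdash^K_{\mathcal{C}}p$ then $\Vdash^{L\uplus K}_{\mathcal{C}}p$; ($\mathbin{\&}$) $\Vdash^L_{\mathcal{B}}\varphi\mathbin{\&}\psi$ iff $\Vdash^L_{\mathcal{B}}\varphi$ and $\Vdash^L_{\mathcal{B}}\psi$; ($\oplus$) $\Vdash^L_{\mathcal{B}}\varphi\oplus\psi$ iff for all $\mathcal{C}\supseteq\mathcal{B}$, $K$, $p$: if $\varphi\Vdash^K_{\mathcal{C}}p$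 and $\psi\Vdash^K_{\mathcal{C}}p$ then $\Vdash^{L\uplus K}_{\mathcal{C}}p$; ($0$) $\Vdash^L_{\mathcal{B}}0$ iff $\Vdash^{L\uplus K}_{\mathcal{B}}p$ for all atoms $p$ and atomic multisets $K$; ($\top$) $\Vdash^L_{\mathcal{B}}\top$ always; ($!$) $\Vdash^L_{\mathcal{B}}\,!\varphi$ iff for all $\mathcal{C}\supseteq\mathcal{B}$, $K$, $p$: if (for all $\mathcal{D}\supseteq\mathcal{C}$, $\Vdash^{\varnothing}_{\mathcal{D}}\varphi$ implies $\Vdash^K_{\mathcal{D}}p$) then $\Vdash^{L\uplus K}_{\mathcal{C}}p$. Multisets: $\Vdash^L_{\mathcal{B}}\varnothing$ iff $L=\varnothing$; $\Vdash^L_{\mathcal{B}}\{\varphi\}$ iff $\Vdash^L_{\mathcal{B}}\varphi$; $\Vdash^L_{\mathcal{B}}\Gamma\uplus\Delta$ iff $L=K\uplus M$ for some $K,M$ with $\Vdash^K_{\mathcal{B}}\Gamma$, $\Vdash^M_{\mathcal{B}}\Delta$. (Inf) For non-empty $\Gamma$, write $\Gamma=\,!\Delta\uplus\Theta$ with $!\Delta$ the elements whose top-level connective is $!$ and $\Theta$ the rest; $\Gamma\Vdash^L_{\mathcal{B}}\varphi$ iff for all $\mathcal{C}\supseteq\mathcal{B}$ and atomic $K$: if $\Vdash^{\varnothing}_{\mathcal{C}}\delta$ for every $\delta\in\Delta$ and $\Vdash^K_{\mathcal{C}}\Theta$, then $\Vdash^{L\uplus K}_{\mathcal{C}}\varphi$.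 For $\Gamma=\varnothing$, $\Gamma\Vdash^L_{\mathcal{B}}\varphi$ means $\Vdash^L_{\mathcal{B}}\varphi$. -}

module Defs where

open import Level using (Lift; lift) renaming (zero to 0ℓ; suc to lsuc)
open import Data.Unit using (⊤; tt)
open import Data.Product using (Σ; ∃; _×_; _,_; proj₁; proj₂)
open import Data.List using (List; []; _∷_; [_]; _++_; concat; map)
open import Data.List.Membership.Propositional using (_∈_)
open import Data.List.Relation.Unary.All using (All)
open import Data.List.Relation.Binary.Pointwise using (Pointwise)
open import Data.List.Relation.Binary.Permutation.Propositional using (_↭_)
open import Relation.Binary.PropositionalEquality using (_≢_)

-- Conventions.  The set of atoms is an arbitrary type `A`.
-- Finite multisets are represented by lists; multiset equality is
-- `_↭_` (permutation) and multiset union `⊎` is `_++_`.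

module _ {A : Set} where

  AMS : Set
  AMS = List A

  data Form : Set where
    atom : A → Form
    ⊤ᶠ   : Form
    𝟎    : Form
    𝟏    : Form
    _⊸_  : Form → Form → Form
    _⊗_  : Form → Form → Form
    _&_  : Form → Form → Form
    _⊕_  : Form → Form → Form
    !_   : Form → Form

  record Sequent : Set where
    constructor _⇒_
    field
      lhs : AMS
      rhs : A
  open Sequent public

  Box : Set
  Box = List Sequent

  record Rule : Set where
    constructor ⟨_,_,_⟩
    field
      boxes : List Box
      sbox  : Box
      concl : A
  open Rule public

  Base : Set₁
  Base = Rule → Set

  _⊇_ : Base → Base → Set
  C ⊇ B = ∀ r → B r → C r

  Persistent : Base → A → Set
  Persistent B p = Σ Box λ S → (S ≢ []) × B ⟨ [] , S , p ⟩

  -- derivability  P ⊢_ℬ p  (written  B ⊢ P ∶ p)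
  -- In (App): `Cs` are C₁..Cₘ aligned with the boxes T₁..Tₘ of the rule,
  -- `ext` lists the pairs (Cⱼ , dⱼ) for m < j ≤ n, D = map proj₂ ext.
  data _⊢_∶_ (B : Base) : AMS → A → Set where
    ref : ∀ {L p} → L ↭ [ p ] → B ⊢ L ∶ p
    app : ∀ {L} (r : Rule) → B r →
          (Cs : List AMS) → (ext : List (AMS × A)) →
          Pointwise (λ C T → ∀ {s} → s ∈ T → B ⊢ (C ++ lhs s) ∶ rhs s) Cs (boxes r) →
          All (λ Cd → Persistent B (proj₂ Cd) × (B ⊢ proj₁ Cd ∶ proj₂ Cd)) ext →
          (∀ {s} → s ∈ sbox r → B ⊢ (map proj₂ ext ++ lhs s) ∶ rhs s) →
          L ↭ (concat Cs ++ concat (map proj₁ ext)) →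
          B ⊢ L ∶ concl r

  -- A "kind" records the semantic contribution of a formula γ in a
  -- context Γ: if γ = !δ it contributes the condition ⊩^∅_𝒞 δ (Δ part),
  -- otherwise it is part of Θ with its support relation ⊩^K_𝒞 γ.
  data Kind : Set₂ where
    bang  : (Base → Set₁) → Kind
    plain : (Base → AMS → Set₁) → Kind

  BangsHold : List Kind → Base → Set₁
  BangsHold []              C = Lift (lsuc 0ℓ) ⊤
  BangsHold (bang s  ∷ ks)  C = s C × BangsHold ks C
  BangsHold (plain _ ∷ ks)  C = BangsHold ks C

  Theta : List Kind → List (Base → AMS → Set₁)
  Theta []             = []
  Theta (bang _  ∷ ks) = Theta ks
  Theta (plain s ∷ ks) = s ∷ Theta ks

  MultiSup : List (Base → AMS → Set₁) → Base → AMS → Set₁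
  MultiSup []              C K = Lift (lsuc 0ℓ) (K ↭ [])
  MultiSup (s ∷ [])        C K = s C K
  MultiSup (s ∷ s' ∷ ss)   C K =
    Σ AMS λ K₁ → Σ AMS λ K₂ → Lift (lsuc 0ℓ) (K ↭ (K₁ ++ K₂)) ×
      (s C K₁ × MultiSup (s' ∷ ss) C K₂)

  InfK : List Kind → (Base → AMS → Set₁) → Base → AMS → Set₁
  InfK []         tgt B L = tgt B L
  InfK ks@(_ ∷ _) tgt B L =
    ∀ (C : Base) → C ⊇ B → ∀ (K : AMS) →
      BangsHold ks C → MultiSup (Theta ks) C K → tgt C (L ++ K)

  AtSup : A → Base → AMS → Set₁
  AtSup p B L = Lift (lsuc 0ℓ) (B ⊢ L ∶ p)

  mutual
    Sup : Form → Base → AMS → Set₁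
    Sup (atom p) B L = AtSup p B L
    Sup (φ ⊸ ψ)  B L = InfK (kind φ ∷ []) (λ C M → Sup ψ C M) B L
    Sup (φ ⊗ ψ)  B L = ∀ (C : Base) → C ⊇ B → ∀ (K : AMS) (p : A) →
      InfK (kind φ ∷ kind ψ ∷ []) (AtSup p) C K → AtSup p C (L ++ K)
    Sup 𝟏        B L = ∀ (C : Base) → C ⊇ B → ∀ (K : AMS) (p : A) →
      AtSup p C K → AtSup p C (L ++ K)
    Sup (φ & ψ)  B L = Sup φ B L × Sup ψ B L
    Sup (φ ⊕ ψ)  B L = ∀ (C : Base) → C ⊇ B → ∀ (K : AMS) (p : A) →
      InfK (kind φ ∷ []) (AtSup p) C K →
      InfK (kind ψ ∷ []) (AtSup p) C K → AtSup p C (L ++ K)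
    Sup 𝟎        B L = ∀ (p : A) (K : AMS) → AtSup p B (L ++ K)
    Sup ⊤ᶠ       B L = Lift (lsuc 0ℓ) ⊤
    Sup (! φ)    B L = ∀ (C : Base) → C ⊇ B → ∀ (K : AMS) (p : A) →
      (∀ (D : Base) → D ⊇ C → Sup φ D [] → AtSup p D K) →
      AtSup p C (L ++ K)

    kind : Form → Kind
    kind (! δ) = bang (λ C → Sup δ C [])
    kind φ     = plain (Sup φ)

  _⊩[_,_]_ : List Form → Base → AMS → Form → Set₁
  Γ ⊩[ B , L ] φ = InfK (map kind Γ) (Sup φ) B L

{-# OPTIONS --safe #-}
-- Derivability in a base admits cut (a derivation of q may be substituted for an
-- occurrence of q in the context) and is preserved by extending the base.  If
-- L ⊎ K ⊢_B p and K′ supports the atoms of L in an extension C of B, cutting the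
-- derivations of those atoms from parts of K′ yields K′ ⊎ K ⊢_C p.  Conversely,
-- L supports itself in B by (Ref), so instantiating the support clause at C = B
-- and K′ = L yields L ⊎ K ⊢_B p.
module Submission where

open import Defs
open import Level using (lift; lower)
open import Data.Unit using (tt)
open import Data.List using ([]; _∷_; [_]; map; _++_; concat)
open import Data.Product using (∃; _×_; _,_; proj₁; proj₂)
open import Data.Sum using (inj₁; inj₂)
open import Data.List.Membership.Propositional using (_∈_)
open import Data.List.Membership.Propositional.Properties using (∈-++⁻; ∈-∃++)
open import Data.List.Relation.Unary.All using (All; []; _∷_)
open import Data.List.Relation.Unary.Any using (here)
open import Data.List.Relation.Binary.Pointwise using (Pointwise; []; _∷_)
open import Data.List.Relation.Binary.Permutation.Propositional
  using (_↭_; ↭-refl; ↭-sym; ↭-trans)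
open import Data.List.Relation.Binary.Permutation.Propositional.Properties
  using (∈-resp-↭; ↭-singleton-inv; ++⁺ˡ; ++⁺ʳ; shift; shifts; drop-∷; ++-identityʳ; ++-assoc; ++-comm)
open import Relation.Binary.PropositionalEquality using (_≡_; refl; sym; cong; subst)

module _ {A : Set} where

  ∈⇒↭∷ : ∀ {q : A} {X} → q ∈ X → ∃ λ R → X ↭ q ∷ R
  ∈⇒↭∷ {q} q∈X with ys , zs , refl ← ∈-∃++ q∈X = ys ++ zs , shift q ys zs

  -- Y is X with one occurrence of q replaced by M, stated without multiset subtraction.
  record _[_≔_]↭_ (X : AMS {A}) (q : A) (M Y : AMS {A}) : Set where
    constructor replacing
    field q∷Y↭M++X : q ∷ Y ↭ M ++ X

  replace-∷ : ∀ {X q M R} → X ↭ q ∷ R → X [ q ≔ M ]↭ (M ++ R)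
  replace-∷ {q = q} {M} {R} X↭q∷R =
    replacing (↭-trans (↭-sym (shift q M R)) (++⁺ˡ M (↭-sym X↭q∷R)))

  replace-++ʳ : ∀ {X Y q M} Z → X [ q ≔ M ]↭ Y → (X ++ Z) [ q ≔ M ]↭ (Y ++ Z)
  replace-++ʳ {X} {M = M} Z (replacing r) = replacing (↭-trans (++⁺ʳ Z r) (++-assoc M X Z))

  replace-++ˡ : ∀ {X Y q M} Z → X [ q ≔ M ]↭ Y → (Z ++ X) [ q ≔ M ]↭ (Z ++ Y)
  replace-++ˡ {Y = Y} {q} {M} Z (replacing r) =
    replacing (↭-trans (↭-sym (shift q Z Y)) (↭-trans (++⁺ˡ Z r) (shifts Z M)))

  replace-functional : ∀ {X Y Y′ q M} → X [ q ≔ M ]↭ Y → X [ q ≔ M ]↭ Y′ → Y ↭ Y′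
  replace-functional (replacing r) (replacing r′) = drop-∷ (↭-trans r (↭-sym r′))

  ⊢-resp-↭ : ∀ {B : Base {A}} {Γ Δ p} → Γ ↭ Δ → B ⊢ Γ ∶ p → B ⊢ Δ ∶ p
  ⊢-resp-↭ Γ↭Δ (ref Γ↭p) = ref (↭-trans (↭-sym Γ↭Δ) Γ↭p)
  ⊢-resp-↭ Γ↭Δ (app r r∈B Cs ext boxes persistent sbox Γ↭) =
    app r r∈B Cs ext boxes persistent sbox (↭-trans (↭-sym Γ↭Δ) Γ↭)

  BoxDerivable : Base {A} → AMS {A} → Box {A} → Set
  BoxDerivable B C T = ∀ {s} → s ∈ T → B ⊢ (C ++ lhs s) ∶ rhs s

  PersistentDerivable : Base {A} → AMS {A} × A → Set
  PersistentDerivable B (C , d) = Persistent B d × (B ⊢ C ∶ d)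

  -- q lies in one of the contexts Cⱼ of the last (App): M takes its place there and the
  -- cut moves into the premises over Cⱼ.  The persistent atoms D are unchanged, so the
  -- premises of the S-box survive as they are.
  mutual
    ⊢-cut : ∀ {B : Base {A}} {Γ N M p q} →
      Γ ↭ q ∷ N → B ⊢ Γ ∶ p → B ⊢ M ∶ q → B ⊢ (M ++ N) ∶ p
    ⊢-cut {M = M} Γ↭q∷N (ref Γ↭p) ⊢q with ↭-singleton-inv (↭-trans (↭-sym Γ↭q∷N) Γ↭p)
    ... | refl = ⊢-resp-↭ (↭-sym (++-identityʳ M)) ⊢q
    ⊢-cut {B} Γ↭q∷N (app r r∈B Cs ext boxes persistent sbox Γ↭) ⊢q
      with ↭-trans (↭-sym Γ↭) Γ↭q∷N
    ... | split with ∈-++⁻ (concat Cs) (∈-resp-↭ (↭-sym split) (here refl))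
    ... | inj₁ q∈Cs with Cs′ , boxes′ , replaced ← ⊢-cut-boxes boxes q∈Cs ⊢q =
      app r r∈B Cs′ ext boxes′ persistent sbox
        (replace-functional (replace-∷ split) (replace-++ʳ (concat (map proj₁ ext)) replaced))
    ... | inj₂ q∈ext
          with ext′ , persistent′ , same-atoms , replaced ← ⊢-cut-persistent persistent q∈ext ⊢q =
      app r r∈B Cs ext′ boxes persistent′
        (λ {s} s∈S → subst (λ D → B ⊢ (D ++ lhs s) ∶ rhs s) (sym same-atoms) (sbox s∈S))
        (replace-functional (replace-∷ split) (replace-++ˡ (concat Cs) replaced))

    ⊢-cut-boxes : ∀ {B : Base {A}} {Cs Ts M q} →
      Pointwise (BoxDerivable B) Cs Ts → q ∈ concat Cs → B ⊢ M ∶ q →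
      ∃ λ Cs′ → Pointwise (BoxDerivable B) Cs′ Ts × concat Cs [ q ≔ M ]↭ concat Cs′
    ⊢-cut-boxes {B} {C ∷ Cs} {T ∷ _} {M} (⊢C ∷ boxes) q∈ ⊢q with ∈-++⁻ C q∈
    ... | inj₁ q∈C with R , C↭q∷R ← ∈⇒↭∷ q∈C =
      (M ++ R) ∷ Cs , ⊢M++R ∷ boxes , replace-++ʳ (concat Cs) (replace-∷ C↭q∷R)
      where
      ⊢M++R : BoxDerivable B (M ++ R) T
      ⊢M++R {s} s∈T =
        ⊢-resp-↭ (↭-sym (++-assoc M R (lhs s))) (⊢-cut (++⁺ʳ (lhs s) C↭q∷R) (⊢C s∈T) ⊢q)
    ... | inj₂ q∈Cs with Cs′ , boxes′ , replaced ← ⊢-cut-boxes boxes q∈Cs ⊢q =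
      C ∷ Cs′ , ⊢C ∷ boxes′ , replace-++ˡ C replaced

    ⊢-cut-persistent : ∀ {B : Base {A}} {ext M q} →
      All (PersistentDerivable B) ext → q ∈ concat (map proj₁ ext) → B ⊢ M ∶ q →
      ∃ λ ext′ → All (PersistentDerivable B) ext′ × map proj₂ ext′ ≡ map proj₂ ext ×
        concat (map proj₁ ext) [ q ≔ M ]↭ concat (map proj₁ ext′)
    ⊢-cut-persistent {ext = (C , d) ∷ ext} {M} ((d-persistent , ⊢d) ∷ persistent) q∈ ⊢q
      with ∈-++⁻ C q∈
    ... | inj₁ q∈C with R , C↭q∷R ← ∈⇒↭∷ q∈C =
      (M ++ R , d) ∷ ext , (d-persistent , ⊢-cut C↭q∷R ⊢d ⊢q) ∷ persistent , refl ,
      replace-++ʳ (concat (map proj₁ ext)) (replace-∷ C↭q∷R)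
    ... | inj₂ q∈ext
          with ext′ , persistent′ , same-atoms , replaced ← ⊢-cut-persistent persistent q∈ext ⊢q =
      (C , d) ∷ ext′ , (d-persistent , ⊢d) ∷ persistent′ , cong (d ∷_) same-atoms ,
      replace-++ˡ C replaced

  mutual
    ⊢-mono : ∀ {B C : Base {A}} {Γ p} → C ⊇ B → B ⊢ Γ ∶ p → C ⊢ Γ ∶ p
    ⊢-mono C⊇B (ref Γ↭p) = ref Γ↭p
    ⊢-mono C⊇B (app r r∈B Cs ext boxes persistent sbox Γ↭) =
      app r (C⊇B r r∈B) Cs ext (boxes-mono C⊇B boxes) (persistent-mono C⊇B persistent)
        (λ s∈S → ⊢-mono C⊇B (sbox s∈S)) Γ↭

    boxes-mono : ∀ {B C : Base {A}} {Cs Ts} → C ⊇ B →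
      Pointwise (BoxDerivable B) Cs Ts → Pointwise (BoxDerivable C) Cs Ts
    boxes-mono C⊇B [] = []
    boxes-mono C⊇B (⊢C ∷ boxes) = (λ s∈T → ⊢-mono C⊇B (⊢C s∈T)) ∷ boxes-mono C⊇B boxes

    persistent-mono : ∀ {B C : Base {A}} {ext} → C ⊇ B →
      All (PersistentDerivable B) ext → All (PersistentDerivable C) ext
    persistent-mono C⊇B [] = []
    persistent-mono C⊇B (((S , S≢[] , S-rule) , ⊢d) ∷ persistent) =
      ((S , S≢[] , C⊇B _ S-rule) , ⊢-mono C⊇B ⊢d) ∷ persistent-mono C⊇B persistent

  AtomsSup : AMS {A} → Base {A} → AMS {A} → Set₁
  AtomsSup L = MultiSup (Theta (map kind (map atom L)))

  BangsHold-atoms : ∀ L (C : Base {A}) → BangsHold (map kind (map atom L)) C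
  BangsHold-atoms []      C = lift tt
  BangsHold-atoms (_ ∷ L) C = BangsHold-atoms L C

  AtomsSup-refl : ∀ L (C : Base {A}) → AtomsSup L C L
  AtomsSup-refl []           C = lift ↭-refl
  AtomsSup-refl (l ∷ [])     C = lift (ref ↭-refl)
  AtomsSup-refl (l ∷ l′ ∷ L) C =
    [ l ] , l′ ∷ L , lift ↭-refl , lift (ref ↭-refl) , AtomsSup-refl (l′ ∷ L) C

  AtomsSup-cut : ∀ L {C : Base {A}} {K Γ p} →
    AtomsSup L C K → C ⊢ (L ++ Γ) ∶ p → C ⊢ (K ++ Γ) ∶ p
  AtomsSup-cut []           {Γ = Γ} (lift K↭[]) ⊢p = ⊢-resp-↭ (↭-sym (++⁺ʳ Γ K↭[])) ⊢p
  AtomsSup-cut (l ∷ [])     (lift ⊢l) ⊢p = ⊢-cut ↭-refl ⊢p ⊢l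
  AtomsSup-cut (l ∷ l′ ∷ L) {K = K} {Γ} (K₁ , K₂ , lift K↭ , lift ⊢l , sup) ⊢p =
    ⊢-resp-↭ K₂K₁Γ↭KΓ
      (AtomsSup-cut (l′ ∷ L) sup (⊢-resp-↭ (shifts K₁ (l′ ∷ L)) (⊢-cut ↭-refl ⊢p ⊢l)))
    where
    K₂K₁Γ↭KΓ : K₂ ++ K₁ ++ Γ ↭ K ++ Γ
    K₂K₁Γ↭KΓ = ↭-trans (shifts K₂ K₁) (↭-trans (↭-sym (++-assoc K₁ K₂ Γ)) (++⁺ʳ Γ (↭-sym K↭)))

mainTheorem6 : ∀ {A : Set} (B : Base {A}) (L K : AMS {A}) (p : A) →
    ((map atom L ⊩[ B , K ] atom p) → B ⊢ (L ++ K) ∶ p) ×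
    (B ⊢ (L ++ K) ∶ p → (map atom L ⊩[ B , K ] atom p))
mainTheorem6 B [] K p = lower , lift
mainTheorem6 B L@(_ ∷ _) K p =
  (λ L⊩p → ⊢-resp-↭ (++-comm K L)
     (lower (L⊩p B (λ _ r∈B → r∈B) L (BangsHold-atoms L B) (AtomsSup-refl L B)))) ,
  (λ ⊢p C C⊇B K′ _ sup → lift (⊢-resp-↭ (++-comm K′ K) (AtomsSup-cut L sup (⊢-mono C⊇B ⊢p))))
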